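{- Let $n,M,\ell$ be positive integers and $I\in\mathbb{N}$. Then \[ \sum_{\substack{i_{1}+\cdots+i_{2M}=I \\ 0\leq i_{1},\ldots,i_{2M}\leq n}}B_{i_{1},\ldots,i_{2M}}^{(\ell)}\equiv0\pmod 2. \]
   Context: For $m\in\mathbb{Z}^+$ and $i_1,\dots,i_m\in\mathbb{N}$, the integers $B_{i_{1},\ldots,i_{m}}^{(\ell)}$ are the unique coefficients (independent of $k$) such that, as polynomials in $k$, \[ \prod_{j=1}^{m}\binom{k+i_{j}}{2i_{j}}\binom{2i_{j}}{i_{j}}=\sum_{\ell=0}^{i_{1}+\cdots+i_{m}}B_{i_{1},\ldots,i_{m}}^{(\ell)}\binom{k+\ell}{2\ell}\binom{2\ell}{\ell}, \] where $\binom{k+\ell}{2\ell}=\frac{(k+\ell)(k+\ell-1)\cdots(k-\ell+1)}{(2\ell)!}$ is a polynomial in $k$ of degree $2\ell$; $B_{i_1,\dots,i_m}^{(\ell)}=0$ for $\ell> i_1+\cdots+i_m$. -}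

module Defs where

open import Data.Nat using (ℕ; zero; suc; _+_; _*_; _<_; _≟_)
open import Data.Nat.Combinatorics using (_C_)
open import Data.Integer using (ℤ; +_; 0ℤ; 1ℤ) renaming (_+_ to _+ℤ_; _*_ to _*ℤ_)
open import Data.Vec using (Vec; []; _∷_)
import Data.Vec as Vec
open import Data.List using (List; []; _∷_; map; concatMap; filter; upTo)
open import Relation.Binary.PropositionalEquality using (_≡_)

-- The binomial-basis polynomial  binom(k+l, 2l) * binom(2l, l), evaluated at a natural k,
-- as an integer.  (For natural k the polynomial binom(k+l,2l) agrees with the ordinary
-- binomial coefficient, including the value 0 when k < l.)
basis : ℕ → ℕ → ℤ
basis k l = + (((k + l) C (2 * l)) * ((2 * l) C l))

prodBasis : ∀ {m} → ℕ → Vec ℕ m → ℤ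
prodBasis k [] = 1ℤ
prodBasis k (i ∷ is) = basis k i *ℤ prodBasis k is

sumUpTo : ℕ → (ℕ → ℤ) → ℤ
sumUpTo zero f = f zero
sumUpTo (suc S) f = sumUpTo S f +ℤ f (suc S)

-- B is the coefficient family B^{(l)}_{i_1..i_m}: for every tuple i, the identity
--   ∏_j binom(k+i_j,2i_j) binom(2i_j,i_j) = Σ_{l=0}^{i_1+..+i_m} B^{(l)}_i binom(k+l,2l) binom(2l,l)
-- holds as polynomials in k (equivalently, for all natural k), and B^{(l)}_i = 0 for l > Σ i.
-- These conditions determine B uniquely.
IsBCoeff : (m : ℕ) → (Vec ℕ m → ℕ → ℤ) → Set
IsBCoeff m B =
  (∀ (i : Vec ℕ m) (k : ℕ) →
     prodBasis k i ≡ sumUpTo (Vec.sum i) (λ l → B i l *ℤ basis k l))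
  × (∀ (i : Vec ℕ m) (l : ℕ) → Vec.sum i < l → B i l ≡ 0ℤ)
  where open import Data.Product using (_×_)

tuples : ℕ → (m : ℕ) → List (Vec ℕ m)
tuples n zero = [] ∷ []
tuples n (suc m) = concatMap (λ a → map (a ∷_) (tuples n m)) (upTo (suc n))

tuplesSum : ℕ → (m : ℕ) → ℕ → List (Vec ℕ m)
tuplesSum n m I = filter (λ v → Vec.sum v ≟ I) (tuples n m)

sumListℤ : List ℤ → ℤ
sumListℤ [] = 0ℤ
sumListℤ (x ∷ xs) = x +ℤ sumListℤ xs

-- Write P_c(k) = binom(k+c,2c) binom(2c,c). Since P_c(k) = 0 for k < c and P_c(c) ≠ 0, a polynomial
-- has at most one expansion in the P_c, so B is unique. The recurrence (c+1)² P_{c+1} = (k−c)(k+c+1) P_c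
-- gives, by induction on q, the two-factor expansion P_a P_q = Σ_c B^{(c)}_{a,q} P_c with
-- B^{(c)}_{a,q} = binom(c,a) binom(c,q) binom(a+q,c). Uniqueness then makes B symmetric in its
-- entries and gives B_{a,q,r} = Σ_c B^{(c)}_{a,q} B_{c,0,r}. In the sum over tuples, those differing
-- by a swap of i₁ and i₂ pair off. Among the rest (i₁ = i₂ = a), a > 0 contributes an even amount since
-- B^{(c)}_{a,a} = binom(c,a)² binom(2a,c) is a multiple of binom(2a,a) = 2 binom(2a−1,a−1), and a = 0
-- drops two entries, until B_{()}^{(ℓ)} = 0 for ℓ ≥ 1.

module Submission where

open import Defs

module _ where
  open import Data.Nat as ℕ using (ℕ; zero; suc; _≤_; _<_; z≤n; s≤s)
  open import Data.Sum using (inj₁; inj₂; [_,_]′)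
  open import Data.Nat.Induction using (<-rec)
  open import Function using (id)
  open import Data.Empty using (⊥-elim)
  open import Relation.Binary.Definitions using (tri<; tri≈; tri>)
  open import Relation.Nullary using (¬_; yes; no; does)
  import Data.Nat.Properties as ℕ
  open import Data.Nat.Combinatorics using (_C_; k>n⇒nCk≡0; nCk+nC[k+1]≡[n+1]C[k+1])
  import Data.Nat.Tactic.RingSolver as ℕ-Solver
  open import Data.Integer using (ℤ; +_; 0ℤ; 1ℤ; _+_; _-_; _*_)
  import Data.Integer.Properties as ℤ
  open import Data.Integer.Tactic.RingSolver using (solve-∀)
  open import Data.Integer.Divisibility.Signed using (_∣_; divides; ∣m⇒∣m*n; ∣n⇒∣m*n; ∣m∣n⇒∣m+n)
  open import Data.Vec as Vec using (Vec; []; _∷_)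
  open import Data.Product using (_,_; proj₁; proj₂)
  open import Data.List using (List; []; _∷_; _++_; map; concatMap; filter; upTo)
  open import Data.List.Properties using (map-++)
  open import Data.Bool using (true; false; if_then_else_)
  open import Relation.Unary using (Decidable)
  open import Relation.Binary.PropositionalEquality

  choose : ℕ → ℕ → ℕ
  choose n       zero    = 1
  choose zero    (suc k) = 0
  choose (suc n) (suc k) = choose n k ℕ.+ choose n (suc k)

  C≡choose : ∀ n k → n C k ≡ choose n k
  C≡choose n       zero    = refl
  C≡choose zero    (suc k) = k>n⇒nCk≡0 {0} {suc k} (s≤s z≤n)
  C≡choose (suc n) (suc k) = begin
    suc n C suc k              ≡⟨ nCk+nC[k+1]≡[n+1]C[k+1] n k ⟨
    n C k ℕ.+ n C suc k        ≡⟨ cong₂ ℕ._+_ (C≡choose n k) (C≡choose n (suc k)) ⟩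
    choose n k ℕ.+ choose n (suc k) ∎
    where open ≡-Reasoning

  n<k⇒choose≡0 : ∀ {n k} → n < k → choose n k ≡ 0
  n<k⇒choose≡0 {zero}  {suc k} _       = refl
  n<k⇒choose≡0 {suc n} {suc k} (s≤s p) = cong₂ ℕ._+_ (n<k⇒choose≡0 p) (n<k⇒choose≡0 (ℕ.m<n⇒m<1+n p))

  choose-n-n : ∀ n → choose n n ≡ 1
  choose-n-n zero    = refl
  choose-n-n (suc n) = cong₂ ℕ._+_ (choose-n-n n) (n<k⇒choose≡0 (ℕ.n<1+n n))

  k≤n⇒0<choose : ∀ {n k} → k ≤ n → 0 < choose n k
  k≤n⇒0<choose {n}     {zero}  _       = s≤s z≤n
  k≤n⇒0<choose {suc n} {suc k} (s≤s p) = ℕ.<-≤-trans (k≤n⇒0<choose p) (ℕ.m≤m+n _ _)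

  choose-n-1 : ∀ n → choose n 1 ≡ n
  choose-n-1 zero    = refl
  choose-n-1 (suc n) = cong suc (choose-n-1 n)

  absorptionℕ : ∀ n k → suc k ℕ.* choose (suc n) (suc k) ≡ suc n ℕ.* choose n k
  absorptionℕ n       zero    = trans (ℕ.*-identityˡ _) (trans (choose-n-1 (suc n)) (sym (ℕ.*-identityʳ _)))
  absorptionℕ zero    (suc k) = ℕ.*-zeroʳ (suc (suc k))
  absorptionℕ (suc n) (suc k) = begin
    suc (suc k) ℕ.* (X ℕ.+ Z)
      ≡⟨ split (suc k) X Z ⟩
    X ℕ.+ suc k ℕ.* X ℕ.+ suc (suc k) ℕ.* Z
      ≡⟨ cong₂ (λ u v → X ℕ.+ u ℕ.+ v) (absorptionℕ n k) (absorptionℕ n (suc k)) ⟩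
    X ℕ.+ suc n ℕ.* choose n k ℕ.+ suc n ℕ.* choose n (suc k)
      ≡⟨ merge (choose n k) (choose n (suc k)) (suc n) ⟩
    suc (suc n) ℕ.* X ∎
    where
    open ≡-Reasoning
    X Z : ℕ
    X = choose (suc n) (suc k)
    Z = choose (suc n) (suc (suc k))
    split : ∀ m x z → suc m ℕ.* (x ℕ.+ z) ≡ x ℕ.+ m ℕ.* x ℕ.+ suc m ℕ.* z
    split = ℕ-Solver.solve-∀
    merge : ∀ a b m → a ℕ.+ b ℕ.+ m ℕ.* a ℕ.+ m ℕ.* b ≡ suc m ℕ.* (a ℕ.+ b)
    merge = ℕ-Solver.solve-∀

  binom : ℕ → ℕ → ℤ
  binom n k = + choose n k

  binom-pascal : ∀ n k → binom (suc n) (suc k) ≡ binom n k + binom n (suc k)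
  binom-pascal n k = refl

  absorption : ∀ n k → + suc k * binom (suc n) (suc k) ≡ + suc n * binom n k
  absorption n k = begin
    + suc k * binom (suc n) (suc k)     ≡⟨ ℤ.pos-* (suc k) _ ⟨
    + (suc k ℕ.* choose (suc n) (suc k)) ≡⟨ cong +_ (absorptionℕ n k) ⟩
    + (suc n ℕ.* choose n k)             ≡⟨ ℤ.pos-* (suc n) _ ⟩
    + suc n * binom n k                  ∎
    where open ≡-Reasoning

  binom-lower-step : ∀ n k → + suc k * binom n (suc k) ≡ (+ n - + k) * binom n k
  binom-lower-step n k = begin
    + suc k * y                     ≡⟨ isolate (+ k) x y ⟩
    + suc k * (x + y) - + suc k * x ≡⟨ cong (_- + suc k * x) pascal-absorption ⟩
    + suc n * x - + suc k * x       ≡⟨ collect (+ n) (+ k) x ⟩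
    (+ n - + k) * x                 ∎
    where
    open ≡-Reasoning
    x y : ℤ
    x = binom n k
    y = binom n (suc k)
    pascal-absorption : + suc k * (x + y) ≡ + suc n * x
    pascal-absorption = trans (cong (+ suc k *_) (sym (binom-pascal n k))) (absorption n k)
    isolate : ∀ k x y → (1ℤ + k) * y ≡ (1ℤ + k) * (x + y) - (1ℤ + k) * x
    isolate = solve-∀
    collect : ∀ n k x → (1ℤ + n) * x - (1ℤ + k) * x ≡ (n - k) * x
    collect = solve-∀

  binom-upper-step : ∀ n k → (+ suc n - + k) * binom (suc n) k ≡ + suc n * binom n k
  binom-upper-step n zero    = drop-zero (+ n)
    where
    drop-zero : ∀ n → (1ℤ + n - 0ℤ) * 1ℤ ≡ (1ℤ + n) * 1ℤ
    drop-zero = solve-∀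
  binom-upper-step n (suc k) = begin
    (+ suc n - + suc k) * (x + y)       ≡⟨ distrib (+ n) (+ k) x y ⟩
    (+ n - + k) * x + (+ n - + k) * y   ≡⟨ cong (_+ (+ n - + k) * y) (binom-lower-step n k) ⟨
    + suc k * y + (+ n - + k) * y       ≡⟨ collect (+ n) (+ k) y ⟩
    + suc n * y                         ∎
    where
    open ≡-Reasoning
    x y : ℤ
    x = binom n k
    y = binom n (suc k)
    distrib : ∀ n k x y → (1ℤ + n - (1ℤ + k)) * (x + y) ≡ (n - k) * x + (n - k) * y
    distrib = solve-∀
    collect : ∀ n k y → (1ℤ + k) * y + (n - k) * y ≡ (1ℤ + n) * y
    collect = solve-∀

  trinomial-revision : ∀ r s j → binom (r ℕ.+ s) (r ℕ.+ j) * binom (r ℕ.+ j) r ≡ binom (r ℕ.+ s) r * binom s j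
  trinomial-revision r s zero rewrite ℕ.+-identityʳ r | choose-n-n r = refl
  trinomial-revision r s (suc j) rewrite ℕ.+-suc r j =
    ℤ.*-cancelˡ-≡ (+ suc (r ℕ.+ j) * + suc j) _ _
      (step (+ r) (+ s) (+ j) (+ (r ℕ.+ s)) (+ (r ℕ.+ j))
            (binom (r ℕ.+ s) (r ℕ.+ j)) (binom (r ℕ.+ s) (suc (r ℕ.+ j))) (binom (r ℕ.+ j) r) (binom (suc (r ℕ.+ j)) r)
            (binom s j) (binom s (suc j)) (binom (r ℕ.+ s) r) (ℤ.pos-+ r s) (ℤ.pos-+ r j)
            (binom-lower-step (r ℕ.+ s) (r ℕ.+ j)) (binom-upper-step (r ℕ.+ j) r) (binom-lower-step s j)
            (trinomial-revision r s j))
    where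
    open ≡-Reasoning
    step : ∀ r s j N M A A′ B B′ C C′ D → N ≡ r + s → M ≡ r + j →
           (1ℤ + M) * A′ ≡ (N - M) * A → (1ℤ + M - r) * B′ ≡ (1ℤ + M) * B →
           (1ℤ + j) * C′ ≡ (s - j) * C → A * B ≡ D * C →
           (1ℤ + M) * (1ℤ + j) * (A′ * B′) ≡ (1ℤ + M) * (1ℤ + j) * (D * C′)
    step r s j _ _ A A′ B B′ C C′ D refl refl hA hB hC ih = begin
      (1ℤ + (r + j)) * (1ℤ + j) * (A′ * B′)                    ≡⟨ e₁ r j A′ B′ ⟩
      ((1ℤ + (r + j)) * A′) * ((1ℤ + (r + j) - r) * B′)        ≡⟨ cong₂ _*_ hA hB ⟩
      ((r + s - (r + j)) * A) * ((1ℤ + (r + j)) * B)           ≡⟨ e₂ (r + s - (r + j)) (1ℤ + (r + j)) A B ⟩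
      (r + s - (r + j)) * (1ℤ + (r + j)) * (A * B)             ≡⟨ cong ((r + s - (r + j)) * (1ℤ + (r + j)) *_) ih ⟩
      (r + s - (r + j)) * (1ℤ + (r + j)) * (D * C)             ≡⟨ e₃ r s j D C ⟩
      (1ℤ + (r + j)) * D * ((s - j) * C)                       ≡⟨ cong ((1ℤ + (r + j)) * D *_) hC ⟨
      (1ℤ + (r + j)) * D * ((1ℤ + j) * C′)                     ≡⟨ e₄ (1ℤ + (r + j)) (1ℤ + j) D C′ ⟩
      (1ℤ + (r + j)) * (1ℤ + j) * (D * C′)                     ∎
      where
      e₁ : ∀ r j A′ B′ → (1ℤ + (r + j)) * (1ℤ + j) * (A′ * B′) ≡ ((1ℤ + (r + j)) * A′) * ((1ℤ + (r + j) - r) * B′)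
      e₁ = solve-∀
      e₂ : ∀ x y A B → (x * A) * (y * B) ≡ x * y * (A * B)
      e₂ = solve-∀
      e₃ : ∀ r s j D C → (r + s - (r + j)) * (1ℤ + (r + j)) * (D * C) ≡ (1ℤ + (r + j)) * D * ((s - j) * C)
      e₃ = solve-∀
      e₄ : ∀ x y D C′ → x * D * (y * C′) ≡ x * y * (D * C′)
      e₄ = solve-∀

  central-binom-halves : ∀ a → binom (suc a ℕ.+ suc a) (suc a) ≡ binom (a ℕ.+ suc a) a * + 2
  central-binom-halves a = ℤ.*-cancelˡ-≡ (+ suc a) _ _ (begin
    + suc a * binom (suc a ℕ.+ suc a) (suc a)    ≡⟨ absorption (a ℕ.+ suc a) a ⟩
    + suc (a ℕ.+ suc a) * Y                      ≡⟨ cong (λ n → + n * Y) (double a) ⟩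
    + (suc a ℕ.* 2) * Y                          ≡⟨ cong (_* Y) (ℤ.pos-* (suc a) 2) ⟩
    + suc a * + 2 * Y                            ≡⟨ e (+ suc a) Y ⟩
    + suc a * (Y * + 2)                          ∎)
    where
    open ≡-Reasoning
    Y : ℤ
    Y = binom (a ℕ.+ suc a) a
    double : ∀ a → suc (a ℕ.+ suc a) ≡ suc a ℕ.* 2
    double = ℕ-Solver.solve-∀
    e : ∀ x y → x * + 2 * y ≡ x * (y * + 2)
    e = solve-∀

  sumUpTo-cong : ∀ L {f g : ℕ → ℤ} → (∀ l → l ≤ L → f l ≡ g l) → sumUpTo L f ≡ sumUpTo L g
  sumUpTo-cong zero    h = h 0 z≤n
  sumUpTo-cong (suc L) h = cong₂ _+_ (sumUpTo-cong L (λ l p → h l (ℕ.m≤n⇒m≤1+n p))) (h (suc L) ℕ.≤-refl)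

  sumUpTo-+ : ∀ L (f g : ℕ → ℤ) → sumUpTo L (λ l → f l + g l) ≡ sumUpTo L f + sumUpTo L g
  sumUpTo-+ zero    f g = refl
  sumUpTo-+ (suc L) f g = trans (cong (_+ (f (suc L) + g (suc L))) (sumUpTo-+ L f g))
    (interchange (sumUpTo L f) (sumUpTo L g) (f (suc L)) (g (suc L)))
    where
    interchange : ∀ a b c d → a + b + (c + d) ≡ a + c + (b + d)
    interchange = solve-∀

  sumUpTo-minus : ∀ L (f g : ℕ → ℤ) → sumUpTo L (λ l → f l - g l) ≡ sumUpTo L f - sumUpTo L g
  sumUpTo-minus zero    f g = refl
  sumUpTo-minus (suc L) f g = trans (cong (_+ (f (suc L) - g (suc L))) (sumUpTo-minus L f g))
    (interchange (sumUpTo L f) (sumUpTo L g) (f (suc L)) (g (suc L)))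
    where
    interchange : ∀ a b c d → a - b + (c - d) ≡ a + c - (b + d)
    interchange = solve-∀

  sumUpTo-*ˡ : ∀ L (c : ℤ) (f : ℕ → ℤ) → c * sumUpTo L f ≡ sumUpTo L (λ l → c * f l)
  sumUpTo-*ˡ zero    c f = refl
  sumUpTo-*ˡ (suc L) c f = trans (ℤ.*-distribˡ-+ c (sumUpTo L f) (f (suc L))) (cong (_+ c * f (suc L)) (sumUpTo-*ˡ L c f))

  sumUpTo-*ʳ : ∀ L (c : ℤ) (f : ℕ → ℤ) → sumUpTo L f * c ≡ sumUpTo L (λ l → f l * c)
  sumUpTo-*ʳ L c f = trans (ℤ.*-comm (sumUpTo L f) c)
    (trans (sumUpTo-*ˡ L c f) (sumUpTo-cong L (λ l _ → ℤ.*-comm c (f l))))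

  sumUpTo-suc : ∀ L (f : ℕ → ℤ) → sumUpTo (suc L) f ≡ f 0 + sumUpTo L (λ l → f (suc l))
  sumUpTo-suc zero    f = refl
  sumUpTo-suc (suc L) f = trans (cong (_+ f (suc (suc L))) (sumUpTo-suc L f)) (ℤ.+-assoc (f 0) _ _)

  sumUpTo-comm : ∀ A B (g : ℕ → ℕ → ℤ) →
                 sumUpTo A (λ a → sumUpTo B (g a)) ≡ sumUpTo B (λ b → sumUpTo A (λ a → g a b))
  sumUpTo-comm zero    B g = refl
  sumUpTo-comm (suc A) B g = trans (cong (_+ sumUpTo B (g (suc A))) (sumUpTo-comm A B g))
    (sym (sumUpTo-+ B (λ b → sumUpTo A (λ a → g a b)) (g (suc A))))

  sumUpTo-zero : ∀ L {f : ℕ → ℤ} → (∀ l → l ≤ L → f l ≡ 0ℤ) → sumUpTo L f ≡ 0ℤ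
  sumUpTo-zero zero    h = h 0 z≤n
  sumUpTo-zero (suc L) h = cong₂ _+_ (sumUpTo-zero L (λ l p → h l (ℕ.m≤n⇒m≤1+n p))) (h (suc L) ℕ.≤-refl)

  sumUpTo-extend : ∀ {L L'} (f : ℕ → ℤ) → L ≤ L' → (∀ l → L < l → f l ≡ 0ℤ) → sumUpTo L' f ≡ sumUpTo L f
  sumUpTo-extend {L} {L'} f p h with ℕ.m≤n⇒m<n∨m≡n p
  ... | inj₂ refl = refl
  sumUpTo-extend {L} {suc L'} f p h | inj₁ (s≤s q) =
    trans (cong₂ _+_ (sumUpTo-extend f q h) (h (suc L') (s≤s q))) (ℤ.+-identityʳ _)

  sumUpTo-single : ∀ {L j} (f : ℕ → ℤ) → j ≤ L → (∀ l → ¬ l ≡ j → f l ≡ 0ℤ) → sumUpTo L f ≡ f j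
  sumUpTo-single {L} {j} f j≤L h =
    trans (sumUpTo-extend f j≤L (λ l j<l → h l (λ l≡j → ℕ.<⇒≢ j<l (sym l≡j)))) (up-to j h)
    where
    up-to : ∀ j → (∀ l → ¬ l ≡ j → f l ≡ 0ℤ) → sumUpTo j f ≡ f j
    up-to zero    h = refl
    up-to (suc j) h = trans (cong (_+ f (suc j)) below) (ℤ.+-identityˡ (f (suc j)))
      where
      below : sumUpTo j f ≡ 0ℤ
      below = sumUpTo-zero j (λ l l≤j → h l (λ l≡1+j → ℕ.<⇒≢ (s≤s l≤j) l≡1+j))

  ∣-sumUpTo : ∀ {d} L {f : ℕ → ℤ} → (∀ l → d ∣ f l) → d ∣ sumUpTo L f
  ∣-sumUpTo zero    h = h 0
  ∣-sumUpTo (suc L) h = ∣m∣n⇒∣m+n (∣-sumUpTo L h) (h (suc L))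

  -- Δ x y = x(x+1) − y(y+1)
  Δ : ℤ → ℤ → ℤ
  Δ x y = (x - y) * (x + y + 1ℤ)

  basis≡binom : ∀ k c → basis k c ≡ binom (k ℕ.+ c) (2 ℕ.* c) * binom (2 ℕ.* c) c
  basis≡binom k c = trans (cong₂ (λ x y → + (x ℕ.* y)) (C≡choose (k ℕ.+ c) (2 ℕ.* c)) (C≡choose (2 ℕ.* c) c))
                          (ℤ.pos-* (choose (k ℕ.+ c) (2 ℕ.* c)) (choose (2 ℕ.* c) c))

  basis-zero : ∀ k → basis k 0 ≡ 1ℤ
  basis-zero k = basis≡binom k 0

  basis-vanishes : ∀ {k l} → k < l → basis k l ≡ 0ℤ
  basis-vanishes {k} {l} k<l = cong (λ x → + (x ℕ.* ((2 ℕ.* l) C l))) (k>n⇒nCk≡0 k+l<2l)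
    where
    k+l<2l : k ℕ.+ l < 2 ℕ.* l
    k+l<2l = subst (k ℕ.+ l <_) (cong (l ℕ.+_) (sym (ℕ.+-identityʳ l))) (ℕ.+-monoˡ-< l k<l)

  basis-diag≢0 : ∀ l → basis l l ≢ 0ℤ
  basis-diag≢0 l eq = ℕ.<⇒≢ central>0 (sym (ℤ.+-injective (trans (sym diag) eq)))
    where
    diag : basis l l ≡ binom (2 ℕ.* l) l
    diag = trans (basis≡binom l l) (trans (cong (λ n → binom n (2 ℕ.* l) * binom (2 ℕ.* l) l) l+l≡2l)
      (trans (cong (_* binom (2 ℕ.* l) l) (cong +_ (choose-n-n (2 ℕ.* l)))) (ℤ.*-identityˡ _)))
      where
      l+l≡2l : l ℕ.+ l ≡ 2 ℕ.* l
      l+l≡2l = cong (l ℕ.+_) (sym (ℕ.+-identityʳ l))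
    central>0 : 0 < choose (2 ℕ.* l) l
    central>0 = k≤n⇒0<choose (ℕ.m≤m+n l (l ℕ.+ 0))

  basis-suc : ∀ k c → basis k (suc c) ≡ binom (suc (k ℕ.+ c)) (suc (suc (2 ℕ.* c))) * binom (suc (suc (2 ℕ.* c))) (suc c)
  basis-suc k c = trans (basis≡binom k (suc c)) (cong₂ (λ n m → binom n m * binom m (suc c)) (ℕ.+-suc k c) (ℕ.*-suc 2 c))

  basis-step : ∀ k c → + suc c * + suc c * basis k (suc c) ≡ Δ (+ k) (+ c) * basis k c
  basis-step k c = begin
    + suc c * + suc c * basis k (suc c)
      ≡⟨ cong (+ suc c * + suc c *_) (basis-suc k c) ⟩
    + suc c * + suc c * (binom (suc N) (suc (suc m)) * binom (suc (suc m)) (suc c))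
      ≡⟨ step (+ k) (+ c) (+ N) (+ m)
              (binom (suc N) (suc (suc m))) (binom N (suc m)) (binom N m)
              (binom (suc (suc m)) (suc c)) (binom (suc m) c) (binom m c)
              (ℤ.pos-+ k c) (ℤ.pos-* 2 c)
              (absorption N (suc m)) (binom-lower-step N m) (absorption (suc m) c) (binom-upper-step m c) ⟩
    Δ (+ k) (+ c) * (binom N m * binom m c)
      ≡⟨ cong (Δ (+ k) (+ c) *_) (basis≡binom k c) ⟨
    Δ (+ k) (+ c) * basis k c ∎
    where
    open ≡-Reasoning
    N m : ℕ
    N = k ℕ.+ c
    m = 2 ℕ.* c
    step : ∀ k c N m X X₁ X₀ Y Y₁ Y₀ → N ≡ k + c → m ≡ + 2 * c →
           (1ℤ + (1ℤ + m)) * X ≡ (1ℤ + N) * X₁ → (1ℤ + m) * X₁ ≡ (N - m) * X₀ →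
           (1ℤ + c) * Y ≡ (1ℤ + (1ℤ + m)) * Y₁ → (1ℤ + m - c) * Y₁ ≡ (1ℤ + m) * Y₀ →
           (1ℤ + c) * (1ℤ + c) * (X * Y) ≡ Δ k c * (X₀ * Y₀)
    step k c _ _ X X₁ X₀ Y Y₁ Y₀ refl refl hX hX₁ hY hY₁ = begin
      (1ℤ + c) * (1ℤ + c) * (X * Y)                        ≡⟨ e₁ c X Y ⟩
      (1ℤ + c) * X * ((1ℤ + c) * Y)                        ≡⟨ cong ((1ℤ + c) * X *_) hY ⟩
      (1ℤ + c) * X * ((1ℤ + (1ℤ + + 2 * c)) * Y₁)          ≡⟨ e₂ c X Y₁ ⟩
      (1ℤ + (1ℤ + + 2 * c)) * X * ((1ℤ + + 2 * c - c) * Y₁) ≡⟨ cong₂ _*_ hX hY₁ ⟩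
      (1ℤ + (k + c)) * X₁ * ((1ℤ + + 2 * c) * Y₀)          ≡⟨ e₃ (k + c) (+ 2 * c) X₁ Y₀ ⟩
      (1ℤ + (k + c)) * ((1ℤ + + 2 * c) * X₁) * Y₀          ≡⟨ cong (λ z → (1ℤ + (k + c)) * z * Y₀) hX₁ ⟩
      (1ℤ + (k + c)) * ((k + c - + 2 * c) * X₀) * Y₀       ≡⟨ e₄ k c X₀ Y₀ ⟩
      Δ k c * (X₀ * Y₀)                                    ∎
      where
      e₁ : ∀ c X Y → (1ℤ + c) * (1ℤ + c) * (X * Y) ≡ (1ℤ + c) * X * ((1ℤ + c) * Y)
      e₁ = solve-∀
      e₂ : ∀ c X Y₁ → (1ℤ + c) * X * ((1ℤ + (1ℤ + + 2 * c)) * Y₁) ≡ (1ℤ + (1ℤ + + 2 * c)) * X * ((1ℤ + + 2 * c - c) * Y₁)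
      e₂ = solve-∀
      e₃ : ∀ N m X₁ Y₀ → (1ℤ + N) * X₁ * ((1ℤ + m) * Y₀) ≡ (1ℤ + N) * ((1ℤ + m) * X₁) * Y₀
      e₃ = solve-∀
      e₄ : ∀ k c X₀ Y₀ → (1ℤ + (k + c)) * ((k + c - + 2 * c) * X₀) * Y₀ ≡ (k - c) * (k + c + 1ℤ) * (X₀ * Y₀)
      e₄ = solve-∀

  -- At k = j the sum is triangular: basis j l = 0 for l > j, and e l = 0 for l < j by induction.
  coefficients-vanish : ∀ L (e : ℕ → ℤ) → (∀ k → sumUpTo L (λ l → e l * basis k l) ≡ 0ℤ) → ∀ j → j ≤ L → e j ≡ 0ℤ
  coefficients-vanish L e H = <-rec (λ j → j ≤ L → e j ≡ 0ℤ) vanish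
    where
    vanish : ∀ j → (∀ {i} → i < j → i ≤ L → e i ≡ 0ℤ) → j ≤ L → e j ≡ 0ℤ
    vanish j below j≤L = [ id , (λ diag≡0 → ⊥-elim (basis-diag≢0 j diag≡0)) ]′ (ℤ.i*j≡0⇒i≡0∨j≡0 (e j) diagonal)
      where
      off-diagonal : ∀ l → l ≢ j → e l * basis j l ≡ 0ℤ
      off-diagonal l l≢j with ℕ.<-cmp l j
      ... | tri< l<j _ _ = cong (_* basis j l) (below l<j (ℕ.≤-trans (ℕ.<⇒≤ l<j) j≤L))
      ... | tri≈ _ l≡j _ = ⊥-elim (l≢j l≡j)
      ... | tri> _ _ j<l = trans (cong (e l *_) (basis-vanishes j<l)) (ℤ.*-zeroʳ (e l))
      diagonal : e j * basis j j ≡ 0ℤ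
      diagonal = trans (sym (sumUpTo-single _ j≤L off-diagonal)) (H j)

  coefficients-unique : ∀ L (c d : ℕ → ℤ) →
                        (∀ k → sumUpTo L (λ l → c l * basis k l) ≡ sumUpTo L (λ l → d l * basis k l)) →
                        ∀ l → l ≤ L → c l ≡ d l
  coefficients-unique L c d H l l≤L = ℤ.i-j≡0⇒i≡j (c l) (d l) (coefficients-vanish L (λ l → c l - d l) H′ l l≤L)
    where
    H′ : ∀ k → sumUpTo L (λ l → (c l - d l) * basis k l) ≡ 0ℤ
    H′ k = begin
      sumUpTo L (λ l → (c l - d l) * basis k l)              ≡⟨ sumUpTo-cong L (λ l _ → distrib (c l) (d l) (basis k l)) ⟩
      sumUpTo L (λ l → c l * basis k l - d l * basis k l)    ≡⟨ sumUpTo-minus L _ _ ⟩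
      sumUpTo L (λ l → c l * basis k l) - sumUpTo L (λ l → d l * basis k l)
                                                             ≡⟨ cong (_- sumUpTo L (λ l → d l * basis k l)) (H k) ⟩
      sumUpTo L (λ l → d l * basis k l) - sumUpTo L (λ l → d l * basis k l)
                                                             ≡⟨ ℤ.+-inverseʳ (sumUpTo L (λ l → d l * basis k l)) ⟩
      0ℤ                                                     ∎
      where
      open ≡-Reasoning
      distrib : ∀ x y p → (x - y) * p ≡ x * p - y * p
      distrib = solve-∀

  B₂ : ℕ → ℕ → ℕ → ℤ
  B₂ a q c = binom c a * binom c q * binom (a ℕ.+ q) c

  B₂-vanishes : ∀ a q {c} → a ℕ.+ q < c → B₂ a q c ≡ 0ℤ
  B₂-vanishes a q {c} p = trans (cong (λ x → binom c a * binom c q * + x) (n<k⇒choose≡0 p)) (ℤ.*-zeroʳ (binom c a * binom c q))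

  B₂↓ : ℕ → ℕ → ℕ → ℤ
  B₂↓ a q zero    = 0ℤ
  B₂↓ a q (suc c) = + suc c * + suc c * B₂ a q c

  B₂-step : ∀ a q c → + suc q * + suc q * B₂ a (suc q) c ≡ Δ (+ c) (+ q) * B₂ a q c + B₂↓ a q c
  B₂-step a zero    zero = trans (lhs≡0 (binom 0 a)) (sym (rhs≡0 (binom 0 a)))
    where
    lhs≡0 : ∀ x → (1ℤ + 0ℤ) * (1ℤ + 0ℤ) * (x * 0ℤ * 1ℤ) ≡ 0ℤ
    lhs≡0 = solve-∀
    rhs≡0 : ∀ x → (0ℤ - 0ℤ) * (0ℤ + 0ℤ + 1ℤ) * (x * 1ℤ * 1ℤ) + 0ℤ ≡ 0ℤ
    rhs≡0 = solve-∀
  B₂-step a (suc q) zero = trans (lhs≡0 (+ suc q) (binom 0 a)) (sym (rhs≡0 (Δ 0ℤ (+ suc q)) (binom 0 a)))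
    where
    lhs≡0 : ∀ s x → (1ℤ + s) * (1ℤ + s) * (x * 0ℤ * 1ℤ) ≡ 0ℤ
    lhs≡0 = solve-∀
    rhs≡0 : ∀ δ x → δ * (x * 0ℤ * 1ℤ) + 0ℤ ≡ 0ℤ
    rhs≡0 = solve-∀
  B₂-step a q (suc d) = begin
    + suc q * + suc q * (X * Yₚ * binom (a ℕ.+ suc q) (suc d))
      ≡⟨ cong (λ n → + suc q * + suc q * (X * Yₚ * binom n (suc d))) (ℕ.+-suc a q) ⟩
    + suc q * + suc q * (X * Yₚ * (Z′ + Z))
      ≡⟨ step (+ a) (+ q) (+ d) (+ (a ℕ.+ q)) X X′ Y Y′ Yₚ Z Z′ (ℤ.pos-+ a q)
              (binom-lower-step (suc d) q) (binom-upper-step d a) (binom-upper-step d q) (binom-lower-step (a ℕ.+ q) d) ⟩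
    Δ (+ suc d) (+ q) * (X * Y * Z) + + suc d * + suc d * (X′ * Y′ * Z′) ∎
    where
    open ≡-Reasoning
    X X′ Y Y′ Yₚ Z Z′ : ℤ
    X  = binom (suc d) a
    X′ = binom d a
    Y  = binom (suc d) q
    Y′ = binom d q
    Yₚ = binom (suc d) (suc q)
    Z  = binom (a ℕ.+ q) (suc d)
    Z′ = binom (a ℕ.+ q) d
    step : ∀ a q d N X X′ Y Y′ Yₚ Z Z′ → N ≡ a + q →
           (1ℤ + q) * Yₚ ≡ (1ℤ + d - q) * Y → (1ℤ + d - a) * X ≡ (1ℤ + d) * X′ →
           (1ℤ + d - q) * Y ≡ (1ℤ + d) * Y′ → (1ℤ + d) * Z ≡ (N - d) * Z′ →
           (1ℤ + q) * (1ℤ + q) * (X * Yₚ * (Z′ + Z))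
             ≡ Δ (1ℤ + d) q * (X * Y * Z) + (1ℤ + d) * (1ℤ + d) * (X′ * Y′ * Z′)
    step a q d _ X X′ Y Y′ Yₚ Z Z′ refl hYₚ hX hY hZ = begin
      (1ℤ + q) * (1ℤ + q) * (X * Yₚ * (Z′ + Z))
        ≡⟨ e₁ q X Yₚ Z Z′ ⟩
      (1ℤ + q) * Yₚ * (X * ((1ℤ + q) * (Z′ + Z)))
        ≡⟨ cong₂ (λ u v → u * (X * v)) hYₚ hZ′ ⟩
      (1ℤ + d - q) * Y * (X * ((+ 2 + d + q) * Z + (1ℤ + d - a) * Z′))
        ≡⟨ e₂ a q d X Y Z Z′ ⟩
      Δ (1ℤ + d) q * (X * Y * Z) + ((1ℤ + d - a) * X) * ((1ℤ + d - q) * Y) * Z′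
        ≡⟨ cong₂ (λ u v → Δ (1ℤ + d) q * (X * Y * Z) + u * v * Z′) hX hY ⟩
      Δ (1ℤ + d) q * (X * Y * Z) + ((1ℤ + d) * X′) * ((1ℤ + d) * Y′) * Z′
        ≡⟨ cong (λ w → Δ (1ℤ + d) q * (X * Y * Z) + w) (e₃ (1ℤ + d) X′ Y′ Z′) ⟩
      Δ (1ℤ + d) q * (X * Y * Z) + (1ℤ + d) * (1ℤ + d) * (X′ * Y′ * Z′) ∎
      where
      hZ′ : (1ℤ + q) * (Z′ + Z) ≡ (+ 2 + d + q) * Z + (1ℤ + d - a) * Z′
      hZ′ = begin
        (1ℤ + q) * (Z′ + Z)                                   ≡⟨ e₄ a q d Z Z′ ⟩
        (a + q - d) * Z′ + ((1ℤ + d - a) * Z′ + (1ℤ + q) * Z) ≡⟨ cong (λ w → w + ((1ℤ + d - a) * Z′ + (1ℤ + q) * Z)) hZ ⟨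
        (1ℤ + d) * Z + ((1ℤ + d - a) * Z′ + (1ℤ + q) * Z)     ≡⟨ e₅ a q d Z Z′ ⟩
        (+ 2 + d + q) * Z + (1ℤ + d - a) * Z′                 ∎
        where
        e₄ : ∀ a q d Z Z′ → (1ℤ + q) * (Z′ + Z) ≡ (a + q - d) * Z′ + ((1ℤ + d - a) * Z′ + (1ℤ + q) * Z)
        e₄ = solve-∀
        e₅ : ∀ a q d Z Z′ → (1ℤ + d) * Z + ((1ℤ + d - a) * Z′ + (1ℤ + q) * Z) ≡ (+ 2 + d + q) * Z + (1ℤ + d - a) * Z′
        e₅ = solve-∀
      e₁ : ∀ q X Yₚ Z Z′ → (1ℤ + q) * (1ℤ + q) * (X * Yₚ * (Z′ + Z)) ≡ (1ℤ + q) * Yₚ * (X * ((1ℤ + q) * (Z′ + Z)))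
      e₁ = solve-∀
      e₂ : ∀ a q d X Y Z Z′ → (1ℤ + d - q) * Y * (X * ((+ 2 + d + q) * Z + (1ℤ + d - a) * Z′))
           ≡ (1ℤ + d - q) * (1ℤ + d + q + 1ℤ) * (X * Y * Z) + ((1ℤ + d - a) * X) * ((1ℤ + d - q) * Y) * Z′
      e₂ = solve-∀
      e₃ : ∀ s X′ Y′ Z′ → (s * X′) * (s * Y′) * Z′ ≡ s * s * (X′ * Y′ * Z′)
      e₃ = solve-∀

  basis-product : ∀ k a q → basis k a * basis k q ≡ sumUpTo (a ℕ.+ q) (λ c → B₂ a q c * basis k c)
  basis-product k a zero = begin
    basis k a * basis k 0                                ≡⟨ cong (basis k a *_) (basis-zero k) ⟩
    basis k a * 1ℤ                                       ≡⟨ ℤ.*-identityʳ (basis k a) ⟩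
    basis k a                                            ≡⟨ ℤ.*-identityˡ (basis k a) ⟨
    1ℤ * basis k a                                       ≡⟨ cong (_* basis k a) B₂-a-0-a ⟨
    B₂ a 0 a * basis k a                                 ≡⟨ sumUpTo-single _ (ℕ.m≤m+n a 0) off-diagonal ⟨
    sumUpTo (a ℕ.+ 0) (λ c → B₂ a 0 c * basis k c)       ∎
    where
    open ≡-Reasoning
    B₂-a-0-a : B₂ a 0 a ≡ 1ℤ
    B₂-a-0-a = cong₂ (λ x y → + x * 1ℤ * + y) (choose-n-n a)
                     (trans (cong (λ n → choose n a) (ℕ.+-identityʳ a)) (choose-n-n a))
    off-diagonal : ∀ c → c ≢ a → B₂ a 0 c * basis k c ≡ 0ℤ
    off-diagonal c c≢a with ℕ.<-cmp c a
    ... | tri< c<a _ _ = cong (λ x → + x * 1ℤ * binom (a ℕ.+ 0) c * basis k c) (n<k⇒choose≡0 c<a)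
    ... | tri≈ _ c≡a _ = ⊥-elim (c≢a c≡a)
    ... | tri> _ _ a<c = cong (_* basis k c) (B₂-vanishes a 0 (subst (_< c) (sym (ℕ.+-identityʳ a)) a<c))
  basis-product k a (suc q) = ℤ.*-cancelˡ-≡ (+ suc q * + suc q) _ _ (trans expand-product (sym expand-sum))
    where
    open ≡-Reasoning
    s Σ↑ ΣΔ : ℤ
    s = + suc q
    Σ↑ = sumUpTo (a ℕ.+ q) (λ c → B₂ a q c * (+ suc c * + suc c * basis k (suc c)))
    ΣΔ = sumUpTo (a ℕ.+ q) (λ c → Δ (+ c) (+ q) * B₂ a q c * basis k c)

    -- Δ k q = Δ k c + Δ c q, and Δ k c · basis k c is the next basis polynomial by basis-step.
    split-Δ : ∀ c → Δ (+ k) (+ q) * (B₂ a q c * basis k c)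
                    ≡ B₂ a q c * (+ suc c * + suc c * basis k (suc c)) + Δ (+ c) (+ q) * B₂ a q c * basis k c
    split-Δ c = trans (telescope (+ k) (+ q) (+ c) (B₂ a q c) (basis k c))
                      (cong (λ w → B₂ a q c * w + Δ (+ c) (+ q) * B₂ a q c * basis k c) (sym (basis-step k c)))
      where
      telescope : ∀ k q c t p → (k - q) * (k + q + 1ℤ) * (t * p) ≡ t * ((k - c) * (k + c + 1ℤ) * p) + (c - q) * (c + q + 1ℤ) * t * p
      telescope = solve-∀

    expand-product : s * s * (basis k a * basis k (suc q)) ≡ Σ↑ + ΣΔ
    expand-product = begin
      s * s * (basis k a * basis k (suc q))                 ≡⟨ e₁ s (basis k a) (basis k (suc q)) ⟩
      basis k a * (s * s * basis k (suc q))                 ≡⟨ cong (basis k a *_) (basis-step k q) ⟩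
      basis k a * (Δ (+ k) (+ q) * basis k q)               ≡⟨ e₂ (basis k a) (Δ (+ k) (+ q)) (basis k q) ⟩
      Δ (+ k) (+ q) * (basis k a * basis k q)               ≡⟨ cong (Δ (+ k) (+ q) *_) (basis-product k a q) ⟩
      Δ (+ k) (+ q) * sumUpTo (a ℕ.+ q) (λ c → B₂ a q c * basis k c)
                                                            ≡⟨ sumUpTo-*ˡ (a ℕ.+ q) (Δ (+ k) (+ q)) _ ⟩
      sumUpTo (a ℕ.+ q) (λ c → Δ (+ k) (+ q) * (B₂ a q c * basis k c))
                                                            ≡⟨ sumUpTo-cong (a ℕ.+ q) (λ c _ → split-Δ c) ⟩
      sumUpTo (a ℕ.+ q) (λ c → B₂ a q c * (+ suc c * + suc c * basis k (suc c)) + Δ (+ c) (+ q) * B₂ a q c * basis k c)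
                                                            ≡⟨ sumUpTo-+ (a ℕ.+ q) _ _ ⟩
      Σ↑ + ΣΔ                                               ∎
      where
      e₁ : ∀ s x y → s * s * (x * y) ≡ x * (s * s * y)
      e₁ = solve-∀
      e₂ : ∀ x y z → x * (y * z) ≡ y * (x * z)
      e₂ = solve-∀

    expand-sum : s * s * sumUpTo (a ℕ.+ suc q) (λ c → B₂ a (suc q) c * basis k c) ≡ Σ↑ + ΣΔ
    expand-sum = begin
      s * s * sumUpTo (a ℕ.+ suc q) (λ c → B₂ a (suc q) c * basis k c)
        ≡⟨ cong (λ L → s * s * sumUpTo L (λ c → B₂ a (suc q) c * basis k c)) (ℕ.+-suc a q) ⟩
      s * s * sumUpTo (suc L) (λ c → B₂ a (suc q) c * basis k c)
        ≡⟨ sumUpTo-*ˡ (suc L) (s * s) _ ⟩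
      sumUpTo (suc L) (λ c → s * s * (B₂ a (suc q) c * basis k c))
        ≡⟨ sumUpTo-cong (suc L) (λ c _ → step-term c) ⟩
      sumUpTo (suc L) (λ c → Δ (+ c) (+ q) * B₂ a q c * basis k c + B₂↓ a q c * basis k c)
        ≡⟨ sumUpTo-+ (suc L) _ _ ⟩
      sumUpTo (suc L) (λ c → Δ (+ c) (+ q) * B₂ a q c * basis k c) + sumUpTo (suc L) (λ c → B₂↓ a q c * basis k c)
        ≡⟨ cong₂ _+_ (sumUpTo-extend _ (ℕ.n≤1+n L) top-vanishes) (sumUpTo-suc L _) ⟩
      ΣΔ + (0ℤ * basis k 0 + sumUpTo L (λ c → B₂↓ a q (suc c) * basis k (suc c)))
        ≡⟨ cong (λ w → ΣΔ + w) (ℤ.+-identityˡ _) ⟩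
      ΣΔ + sumUpTo L (λ c → B₂↓ a q (suc c) * basis k (suc c))
        ≡⟨ cong (λ w → ΣΔ + w) (sumUpTo-cong L (λ c _ → e (+ suc c * + suc c) (B₂ a q c) (basis k (suc c)))) ⟩
      ΣΔ + Σ↑
        ≡⟨ ℤ.+-comm ΣΔ Σ↑ ⟩
      Σ↑ + ΣΔ ∎
      where
      L : ℕ
      L = a ℕ.+ q
      step-term : ∀ c → s * s * (B₂ a (suc q) c * basis k c) ≡ Δ (+ c) (+ q) * B₂ a q c * basis k c + B₂↓ a q c * basis k c
      step-term c = begin
        s * s * (B₂ a (suc q) c * basis k c)                          ≡⟨ ℤ.*-assoc (s * s) (B₂ a (suc q) c) (basis k c) ⟨
        s * s * B₂ a (suc q) c * basis k c                            ≡⟨ cong (_* basis k c) (B₂-step a q c) ⟩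
        (Δ (+ c) (+ q) * B₂ a q c + B₂↓ a q c) * basis k c            ≡⟨ ℤ.*-distribʳ-+ (basis k c) (Δ (+ c) (+ q) * B₂ a q c) (B₂↓ a q c) ⟩
        Δ (+ c) (+ q) * B₂ a q c * basis k c + B₂↓ a q c * basis k c  ∎
      top-vanishes : ∀ c → L < c → Δ (+ c) (+ q) * B₂ a q c * basis k c ≡ 0ℤ
      top-vanishes c L<c = begin
        Δ (+ c) (+ q) * B₂ a q c * basis k c ≡⟨ cong (λ x → Δ (+ c) (+ q) * x * basis k c) (B₂-vanishes a q L<c) ⟩
        Δ (+ c) (+ q) * 0ℤ * basis k c       ≡⟨ cong (_* basis k c) (ℤ.*-zeroʳ (Δ (+ c) (+ q))) ⟩
        0ℤ * basis k c                       ≡⟨ ℤ.*-zeroˡ (basis k c) ⟩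
        0ℤ                                   ∎
      e : ∀ s t p → s * t * p ≡ t * (s * p)
      e = solve-∀

  -- binom 2a (a + j) · binom (a + j) a = binom 2a a · binom a j, and binom 2a a is even.
  2∣B₂-diagonal-from : ∀ a j → + 2 ∣ B₂ (suc a) (suc a) (suc a ℕ.+ j)
  2∣B₂-diagonal-from a j = subst (+ 2 ∣_) (sym rearranged)
    (∣n⇒∣m*n X (∣m⇒∣m*n (binom (suc a) j) (divides (binom (a ℕ.+ suc a) a) (central-binom-halves a))))
    where
    open ≡-Reasoning
    c : ℕ
    c = suc a ℕ.+ j
    X : ℤ
    X = binom c (suc a)
    rearranged : B₂ (suc a) (suc a) c ≡ X * (binom (suc a ℕ.+ suc a) (suc a) * binom (suc a) j)
    rearranged = begin
      X * X * binom (suc a ℕ.+ suc a) c       ≡⟨ e X (binom (suc a ℕ.+ suc a) c) ⟩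
      X * (binom (suc a ℕ.+ suc a) c * X)     ≡⟨ cong (X *_) (trinomial-revision (suc a) (suc a) j) ⟩
      X * (binom (suc a ℕ.+ suc a) (suc a) * binom (suc a) j) ∎
      where
      e : ∀ x y → x * x * y ≡ x * (y * x)
      e = solve-∀

  2∣B₂-diagonal : ∀ a c → + 2 ∣ B₂ (suc a) (suc a) c
  2∣B₂-diagonal a c with c ℕ.<? suc a
  ... | yes c<a = divides 0ℤ (trans (cong (λ x → + x * + x * binom (suc a ℕ.+ suc a) c) (n<k⇒choose≡0 c<a))
                                    (ℤ.*-zeroˡ (binom (suc a ℕ.+ suc a) c)))
  ... | no  c≮a = subst (λ c → + 2 ∣ B₂ (suc a) (suc a) c) (ℕ.m+[n∸m]≡n (ℕ.≮⇒≥ c≮a))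
                        (2∣B₂-diagonal-from a (c ℕ.∸ suc a))

  prodBasis-merge : ∀ {m} k a q (r : Vec ℕ m) →
                    prodBasis k (a ∷ q ∷ r) ≡ sumUpTo (a ℕ.+ q) (λ c → B₂ a q c * prodBasis k (c ∷ 0 ∷ r))
  prodBasis-merge k a q r = begin
    basis k a * (basis k q * R)                              ≡⟨ ℤ.*-assoc (basis k a) (basis k q) R ⟨
    basis k a * basis k q * R                                ≡⟨ cong (_* R) (basis-product k a q) ⟩
    sumUpTo (a ℕ.+ q) (λ c → B₂ a q c * basis k c) * R       ≡⟨ sumUpTo-*ʳ (a ℕ.+ q) R _ ⟩
    sumUpTo (a ℕ.+ q) (λ c → B₂ a q c * basis k c * R)       ≡⟨ sumUpTo-cong (a ℕ.+ q) (λ c _ → regroup c) ⟩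
    sumUpTo (a ℕ.+ q) (λ c → B₂ a q c * prodBasis k (c ∷ 0 ∷ r)) ∎
    where
    open ≡-Reasoning
    R : ℤ
    R = prodBasis k r
    regroup : ∀ c → B₂ a q c * basis k c * R ≡ B₂ a q c * (basis k c * (basis k 0 * R))
    regroup c = trans (ℤ.*-assoc (B₂ a q c) (basis k c) R)
      (cong (λ x → B₂ a q c * (basis k c * x)) (sym (trans (cong (_* R) (basis-zero k)) (ℤ.*-identityˡ R))))

  sum-swap : ∀ {m} a c (r : Vec ℕ m) → Vec.sum (a ∷ c ∷ r) ≡ Vec.sum (c ∷ a ∷ r)
  sum-swap a c r = swap a c (Vec.sum r)
    where
    swap : ∀ a c s → a ℕ.+ (c ℕ.+ s) ≡ c ℕ.+ (a ℕ.+ s)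
    swap = ℕ-Solver.solve-∀

  sum-merge-≤ : ∀ {m} a q {c} (r : Vec ℕ m) → c ≤ a ℕ.+ q → Vec.sum (c ∷ 0 ∷ r) ≤ Vec.sum (a ∷ q ∷ r)
  sum-merge-≤ a q {c} r c≤ = subst (c ℕ.+ Vec.sum r ≤_) (ℕ.+-assoc a q (Vec.sum r)) (ℕ.+-monoˡ-≤ (Vec.sum r) c≤)

  module Coefficients {m} {B : Vec ℕ m → ℕ → ℤ} (isB : IsBCoeff m B) where

    B-vanishes : ∀ v {l} → Vec.sum v < l → B v l ≡ 0ℤ
    B-vanishes v = proj₂ isB v _

    B-expansion : ∀ v {L} → Vec.sum v ≤ L → ∀ k → prodBasis k v ≡ sumUpTo L (λ l → B v l * basis k l)
    B-expansion v v≤L k = trans (proj₁ isB v k) (sym (sumUpTo-extend _ v≤L high-terms))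
      where
      high-terms : ∀ l → Vec.sum v < l → B v l * basis k l ≡ 0ℤ
      high-terms l p = trans (cong (_* basis k l) (B-vanishes v p)) (ℤ.*-zeroˡ (basis k l))

    B-determined : ∀ v w → Vec.sum v ≡ Vec.sum w → (∀ k → prodBasis k v ≡ prodBasis k w) → ∀ l → B v l ≡ B w l
    B-determined v w sv≡sw same l with l ℕ.≤? Vec.sum v
    ... | yes l≤ = coefficients-unique (Vec.sum v) (B v) (B w) expansions l l≤
      where
      expansions : ∀ k → sumUpTo (Vec.sum v) (λ l → B v l * basis k l) ≡ sumUpTo (Vec.sum v) (λ l → B w l * basis k l)
      expansions k = trans (sym (B-expansion v ℕ.≤-refl k)) (trans (same k) (B-expansion w (ℕ.≤-reflexive (sym sv≡sw)) k))
    ... | no  l≰ = trans (B-vanishes v (ℕ.≰⇒> l≰)) (sym (B-vanishes w (subst (_< l) sv≡sw (ℕ.≰⇒> l≰))))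

  module PairCoefficients {m} {B : Vec ℕ (suc (suc m)) → ℕ → ℤ} (isB : IsBCoeff (suc (suc m)) B) where
    open Coefficients isB

    B-swap : ∀ a c (r : Vec ℕ m) l → B (a ∷ c ∷ r) l ≡ B (c ∷ a ∷ r) l
    B-swap a c r = B-determined (a ∷ c ∷ r) (c ∷ a ∷ r) (sum-swap a c r) (λ k → swap-product (basis k a) (basis k c) (prodBasis k r))
      where
      swap-product : ∀ x y z → x * (y * z) ≡ y * (x * z)
      swap-product = solve-∀

    B-merge : ∀ a q (r : Vec ℕ m) l → B (a ∷ q ∷ r) l ≡ sumUpTo (a ℕ.+ q) (λ c → B₂ a q c * B (c ∷ 0 ∷ r) l)
    B-merge a q r l with l ℕ.≤? Vec.sum (a ∷ q ∷ r)
    ... | yes l≤L = coefficients-unique L (B (a ∷ q ∷ r)) merged expansions l l≤L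
      where
      open ≡-Reasoning
      L : ℕ
      L = Vec.sum (a ∷ q ∷ r)
      merged : ℕ → ℤ
      merged l = sumUpTo (a ℕ.+ q) (λ c → B₂ a q c * B (c ∷ 0 ∷ r) l)
      expansions : ∀ k → sumUpTo L (λ l → B (a ∷ q ∷ r) l * basis k l) ≡ sumUpTo L (λ l → merged l * basis k l)
      expansions k = begin
        sumUpTo L (λ l → B (a ∷ q ∷ r) l * basis k l)
          ≡⟨ B-expansion (a ∷ q ∷ r) ℕ.≤-refl k ⟨
        prodBasis k (a ∷ q ∷ r)
          ≡⟨ prodBasis-merge k a q r ⟩
        sumUpTo (a ℕ.+ q) (λ c → B₂ a q c * prodBasis k (c ∷ 0 ∷ r))
          ≡⟨ sumUpTo-cong (a ℕ.+ q) (λ c c≤ → cong (B₂ a q c *_) (B-expansion (c ∷ 0 ∷ r) (sum-merge-≤ a q r c≤) k)) ⟩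
        sumUpTo (a ℕ.+ q) (λ c → B₂ a q c * sumUpTo L (λ l → B (c ∷ 0 ∷ r) l * basis k l))
          ≡⟨ sumUpTo-cong (a ℕ.+ q) (λ c _ → sumUpTo-*ˡ L (B₂ a q c) _) ⟩
        sumUpTo (a ℕ.+ q) (λ c → sumUpTo L (λ l → B₂ a q c * (B (c ∷ 0 ∷ r) l * basis k l)))
          ≡⟨ sumUpTo-comm (a ℕ.+ q) L _ ⟩
        sumUpTo L (λ l → sumUpTo (a ℕ.+ q) (λ c → B₂ a q c * (B (c ∷ 0 ∷ r) l * basis k l)))
          ≡⟨ sumUpTo-cong L (λ l _ → collect l) ⟩
        sumUpTo L (λ l → merged l * basis k l) ∎
        where
        collect : ∀ l → sumUpTo (a ℕ.+ q) (λ c → B₂ a q c * (B (c ∷ 0 ∷ r) l * basis k l)) ≡ merged l * basis k l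
        collect l = trans (sumUpTo-cong (a ℕ.+ q) (λ c _ → sym (ℤ.*-assoc (B₂ a q c) _ _))) (sym (sumUpTo-*ʳ (a ℕ.+ q) (basis k l) _))
    ... | no  l≰L = trans (B-vanishes (a ∷ q ∷ r) (ℕ.≰⇒> l≰L)) (sym (sumUpTo-zero (a ℕ.+ q) high-terms))
      where
      high-terms : ∀ c → c ≤ a ℕ.+ q → B₂ a q c * B (c ∷ 0 ∷ r) l ≡ 0ℤ
      high-terms c c≤ = trans (cong (B₂ a q c *_) (B-vanishes (c ∷ 0 ∷ r) (ℕ.≤-<-trans (sum-merge-≤ a q r c≤) (ℕ.≰⇒> l≰L))))
                              (ℤ.*-zeroʳ (B₂ a q c))

    2∣B-diagonal : ∀ a (r : Vec ℕ m) l → + 2 ∣ B (suc a ∷ suc a ∷ r) l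
    2∣B-diagonal a r l = subst (+ 2 ∣_) (sym (B-merge (suc a) (suc a) r l))
      (∣-sumUpTo (suc a ℕ.+ suc a) (λ c → ∣m⇒∣m*n (B (c ∷ 0 ∷ r) l) (2∣B₂-diagonal a c)))

    B-tail : IsBCoeff m (λ r → B (0 ∷ 0 ∷ r))
    B-tail = (λ r k → trans (sym (drop-zeros k r)) (proj₁ isB (0 ∷ 0 ∷ r) k)) , (λ r l → proj₂ isB (0 ∷ 0 ∷ r) l)
      where
      drop-zeros : ∀ k r → prodBasis k (0 ∷ 0 ∷ r) ≡ prodBasis k r
      drop-zeros k r rewrite basis-zero k = trans (ℤ.*-identityˡ _) (ℤ.*-identityˡ (prodBasis k r))

  sumListℤ-++ : ∀ (xs ys : List ℤ) → sumListℤ (xs ++ ys) ≡ sumListℤ xs + sumListℤ ys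
  sumListℤ-++ []       ys = sym (ℤ.+-identityˡ _)
  sumListℤ-++ (x ∷ xs) ys = trans (cong (_+_ x) (sumListℤ-++ xs ys)) (sym (ℤ.+-assoc x _ _))

  sumOver : ∀ {A : Set} → (A → ℤ) → List A → ℤ
  sumOver f xs = sumListℤ (map f xs)

  module _ {A : Set} where

    sumOver-cong : ∀ {f g : A → ℤ} xs → (∀ x → f x ≡ g x) → sumOver f xs ≡ sumOver g xs
    sumOver-cong []       h = refl
    sumOver-cong (x ∷ xs) h = cong₂ _+_ (h x) (sumOver-cong xs h)

    sumOver-+ : ∀ (f g : A → ℤ) xs → sumOver (λ x → f x + g x) xs ≡ sumOver f xs + sumOver g xs
    sumOver-+ f g []       = refl
    sumOver-+ f g (x ∷ xs) = trans (cong (_+_ (f x + g x)) (sumOver-+ f g xs)) (interchange (f x) (g x) _ _)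
      where
      interchange : ∀ a b c d → a + b + (c + d) ≡ a + c + (b + d)
      interchange = solve-∀

    sumOver-map : ∀ {B : Set} (f : B → ℤ) (h : A → B) xs → sumOver f (map h xs) ≡ sumOver (λ x → f (h x)) xs
    sumOver-map f h []       = refl
    sumOver-map f h (x ∷ xs) = cong (_+_ (f (h x))) (sumOver-map f h xs)

    sumOver-concatMap : ∀ {B : Set} (f : B → ℤ) (g : A → List B) xs →
                        sumOver f (concatMap g xs) ≡ sumOver (λ x → sumOver f (g x)) xs
    sumOver-concatMap f g []       = refl
    sumOver-concatMap f g (x ∷ xs) = begin
      sumOver f (g x ++ concatMap g xs)                    ≡⟨ cong sumListℤ (map-++ f (g x) (concatMap g xs)) ⟩
      sumListℤ (map f (g x) ++ map f (concatMap g xs))     ≡⟨ sumListℤ-++ (map f (g x)) _ ⟩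
      sumOver f (g x) + sumOver f (concatMap g xs)         ≡⟨ cong (_+_ (sumOver f (g x))) (sumOver-concatMap f g xs) ⟩
      sumOver f (g x) + sumOver (λ x → sumOver f (g x)) xs ∎
      where open ≡-Reasoning

    sumOver-filter : ∀ {P : A → Set} (P? : Decidable P) (f : A → ℤ) xs →
                     sumOver f (filter P? xs) ≡ sumOver (λ x → if does (P? x) then f x else 0ℤ) xs
    sumOver-filter P? f []       = refl
    sumOver-filter P? f (x ∷ xs) with does (P? x)
    ... | true  = cong (_+_ (f x)) (sumOver-filter P? f xs)
    ... | false = trans (sumOver-filter P? f xs) (sym (ℤ.+-identityˡ _))

    ∣-sumOver : ∀ {d} {f : A → ℤ} xs → (∀ x → d ∣ f x) → d ∣ sumOver f xs
    ∣-sumOver []       h = divides 0ℤ refl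
    ∣-sumOver (x ∷ xs) h = ∣m∣n⇒∣m+n (h x) (∣-sumOver xs h)

    -- Off-diagonal terms H a c and H c a pair up.
    2∣sumOver-symmetric : ∀ (H : A → A → ℤ) → (∀ a c → H a c ≡ H c a) → (∀ a → + 2 ∣ H a a) →
                          ∀ xs → + 2 ∣ sumOver (λ a → sumOver (H a) xs) xs
    2∣sumOver-symmetric H sym-H 2∣diag []       = divides 0ℤ refl
    2∣sumOver-symmetric H sym-H 2∣diag (x ∷ xs) = subst (+ 2 ∣_) (sym split)
      (∣m∣n⇒∣m+n (∣m∣n⇒∣m+n (2∣diag x) (divides Σx (double Σx))) (2∣sumOver-symmetric H sym-H 2∣diag xs))
      where
      open ≡-Reasoning
      Σx Σrest : ℤ
      Σx = sumOver (H x) xs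
      Σrest = sumOver (λ a → sumOver (H a) xs) xs
      double : ∀ y → y + y ≡ y * + 2
      double = solve-∀
      regroup : ∀ a b c → a + b + (b + c) ≡ a + (b + b) + c
      regroup = solve-∀
      split : sumOver (λ a → sumOver (H a) (x ∷ xs)) (x ∷ xs) ≡ H x x + (Σx + Σx) + Σrest
      split = begin
        H x x + Σx + sumOver (λ a → H a x + sumOver (H a) xs) xs ≡⟨ cong (_+_ (H x x + Σx)) (sumOver-+ (λ a → H a x) _ xs) ⟩
        H x x + Σx + (sumOver (λ a → H a x) xs + Σrest)         ≡⟨ cong (λ y → H x x + Σx + (y + Σrest)) (sumOver-cong xs (λ a → sym-H a x)) ⟩
        H x x + Σx + (Σx + Σrest)                                ≡⟨ regroup (H x x) Σx Σrest ⟩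
        H x x + (Σx + Σx) + Σrest                                ∎

  sumOver-tuples-suc : ∀ n m (F : Vec ℕ (suc m) → ℤ) →
                       sumOver F (tuples n (suc m)) ≡ sumOver (λ a → sumOver (λ v → F (a ∷ v)) (tuples n m)) (upTo (suc n))
  sumOver-tuples-suc n m F = trans (sumOver-concatMap F (λ a → map (a ∷_) (tuples n m)) (upTo (suc n)))
    (sumOver-cong (upTo (suc n)) (λ a → sumOver-map F (a ∷_) (tuples n m)))

  twice : ℕ → ℕ
  twice zero    = zero
  twice (suc M) = suc (suc (twice M))

  twice≡2* : ∀ M → twice M ≡ 2 ℕ.* M
  twice≡2* zero    = refl
  twice≡2* (suc M) = trans (cong (λ n → suc (suc n)) (twice≡2* M)) (sym (ℕ.*-suc 2 M))

  restrictSum : ℕ → ∀ {m} → (Vec ℕ m → ℤ) → Vec ℕ m → ℤ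
  restrictSum I f v = if does (Vec.sum v ℕ.≟ I) then f v else 0ℤ

  ∣-restrictSum : ∀ {d} I {m} (f : Vec ℕ m → ℤ) v → d ∣ f v → d ∣ restrictSum I f v
  ∣-restrictSum I f v d∣fv with does (Vec.sum v ℕ.≟ I)
  ... | true  = d∣fv
  ... | false = divides 0ℤ refl

  2∣sumOver-restrictSum : ∀ n I {l} → 0 < l → ∀ M {B : Vec ℕ (twice M) → ℕ → ℤ} → IsBCoeff (twice M) B →
                          + 2 ∣ sumOver (restrictSum I (λ v → B v l)) (tuples n (twice M))
  2∣sumOver-restrictSum n I {l} 0<l zero {B} isB =
    ∣m∣n⇒∣m+n (∣-restrictSum I (λ v → B v l) [] (divides 0ℤ (B-vanishes [] 0<l))) (divides 0ℤ refl)
    where open Coefficients isB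
  2∣sumOver-restrictSum n I {l} 0<l (suc M) {B} isB =
    subst (+ 2 ∣_) (sym double-sum) (2∣sumOver-symmetric H H-sym H-diag U)
    where
    open PairCoefficients isB
    U : List ℕ
    U = upTo (suc n)
    R : List (Vec ℕ (twice M))
    R = tuples n (twice M)
    F : Vec ℕ (twice (suc M)) → ℤ
    F = restrictSum I (λ v → B v l)
    H : ℕ → ℕ → ℤ
    H a c = sumOver (λ r → F (a ∷ c ∷ r)) R
    double-sum : sumOver F (tuples n (twice (suc M))) ≡ sumOver (λ a → sumOver (H a) U) U
    double-sum = trans (sumOver-tuples-suc n _ F) (sumOver-cong U (λ a → sumOver-tuples-suc n _ (λ v → F (a ∷ v))))
    H-sym : ∀ a c → H a c ≡ H c a
    H-sym a c = sumOver-cong R (λ r → cong₂ (λ s x → if does (s ℕ.≟ I) then x else 0ℤ) (sum-swap a c r) (B-swap a c r l))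
    H-diag : ∀ a → + 2 ∣ H a a
    H-diag zero    = 2∣sumOver-restrictSum n I 0<l M B-tail
    H-diag (suc a) = ∣-sumOver R (λ r → ∣-restrictSum I (λ v → B v l) (suc a ∷ suc a ∷ r) (2∣B-diagonal a r l))

  2∣sumOver-tuplesSum : ∀ n M I {l} → 0 < l → ∀ {m} → twice M ≡ m → {B : Vec ℕ m → ℕ → ℤ} → IsBCoeff m B →
                        + 2 ∣ sumOver (λ v → B v l) (tuplesSum n m I)
  2∣sumOver-tuplesSum n M I {l} 0<l refl {B} isB =
    subst (+ 2 ∣_) (sym (sumOver-filter (λ v → Vec.sum v ℕ.≟ I) (λ v → B v l) (tuples n (twice M))))
      (2∣sumOver-restrictSum n I 0<l M isB)

open import Data.Nat using (ℕ; _*_; NonZero; >-nonZero⁻¹)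
open import Data.Integer using (ℤ; +_)
open import Data.Integer.Divisibility using (_∣_)
open import Data.Integer.Divisibility.Signed using (∣⇒∣ᵤ)
open import Data.Vec using (Vec)
open import Data.List using (map)

lemma2p7 : (n M l I : ℕ) → NonZero n → NonZero M → NonZero l →
    (B : Vec ℕ (2 * M) → ℕ → ℤ) → IsBCoeff (2 * M) B →
    (+ 2) ∣ sumListℤ (map (λ i → B i l) (tuplesSum n (2 * M) I))
lemma2p7 n M l I _ _ l≢0 B isB =
  ∣⇒∣ᵤ (2∣sumOver-tuplesSum n M I (>-nonZero⁻¹ l {{l≢0}}) (twice≡2* M) isB)
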